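{- Let $i$ be a positive integer, let $D$ be an $(i,2)$ digraph, and let $C$ be a cycle of length $l \geq 4$ in $P(D)$ which is the cycle obtained from some hole $H$ (of length at least $5$) in $U(D)$ by $\Gamma_H$. If every clique of the subgraph of $P(D)$ induced by $V(C)$ has size at most $\lfloor (l-1)/2 \rfloor$, then the subgraph of $P(D)$ induced by $V(C)$ contains a hole.
   Context: An $(i,j)$ digraph is an acyclic digraph in which every vertex has indegree at most $i$ and outdegree at most $j$. $U(D)$ is the underlying graph of $D$ (edge $uv$ iff $(u,v)$ or $(v,u)$ is an arc). The phylogeny graph $P(D)$ has vertex set $V(D)$ and an edge between distinct $u,v$ iff $(u,v)\in A(D)$ or $(v,u)\in A(D)$ or $u,v$ have a common out-neighbor. A hole is an induced cycle of length at least $4$. For a hole $H=v_1\cdots v_lv_1$ of $U(D)$ with length at least $5$, $\Gamma_H$ is the set of vertices of $H$ with exactly two in-neighbors in the subdigraph $D_H$ of $D$ induced by $V(H)$ (no two consecutive on $H$), and the cycle obtained from $H$ by $\Gamma_H$ is the cycle in $P(D)$ on $V(H)-\Gamma_H$ in the cyclic order of $H$ (each path $v_{a-1}v_av_{a+1}$ with $v_a\in\Gamma_H$ replaced by the edge $v_{a-1}v_{a+1}$). -}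

module Defs where

open import Data.Nat using (ℕ; zero; suc; _+_; _≤_; _∸_; _/_; _≡ᵇ_)
open import Data.Bool using (Bool; true; false; if_then_else_; not)
open import Data.Fin using (Fin; zero; suc; toℕ; inject₁; fromℕ)
open import Data.List using (List; length)
open import Data.List.Membership.Propositional using (_∈_)
open import Data.List.Relation.Unary.All using (All)
open import Data.List.Relation.Unary.Unique.Propositional using (Unique)
open import Data.Product using (Σ; ∃; _×_)
open import Data.Sum using (_⊎_)
open import Relation.Binary.PropositionalEquality using (_≡_; _≢_)
open import Relation.Nullary using (¬_)

count : ∀ {n} → (Fin n → Bool) → ℕ
count {zero} f = 0
count {suc n} f = (if f zero then 1 else 0) + count (λ x → f (suc x))

Digraph : ℕ → Set
Digraph n = Fin n → Fin n → Bool

module _ {n : ℕ} (D : Digraph n) where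

  Arc : Fin n → Fin n → Set
  Arc u v = D u v ≡ true

  outdeg indeg : Fin n → ℕ
  outdeg u = count (λ w → D u w)
  indeg  v = count (λ w → D w v)

  Acyclic : Set
  Acyclic = ∀ (k : ℕ) (w : Fin (suc (suc k)) → Fin n)
            → (∀ (j : Fin (suc k)) → Arc (w (inject₁ j)) (w (suc j)))
            → w zero ≢ w (fromℕ (suc k))

  IJDigraph : ℕ → ℕ → Set
  IJDigraph i j = Acyclic × (∀ v → indeg v ≤ i) × (∀ v → outdeg v ≤ j)

  UEdge : Fin n → Fin n → Set
  UEdge u v = u ≢ v × (Arc u v ⊎ Arc v u)

  PEdge : Fin n → Fin n → Set
  PEdge u v = u ≢ v × (Arc u v ⊎ Arc v u ⊎ ∃ λ w → Arc u w × Arc v w)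

CycAdj : (L : ℕ) → Fin L → Fin L → Set
CycAdj L j k = suc (toℕ j) ≡ toℕ k
             ⊎ suc (toℕ k) ≡ toℕ j
             ⊎ (toℕ j ≡ 0 × suc (toℕ k) ≡ L)
             ⊎ (toℕ k ≡ 0 × suc (toℕ j) ≡ L)

IsHole : ∀ {n} → (Fin n → Fin n → Set) → (L : ℕ) → (Fin L → Fin n) → Set
IsHole G L v = 4 ≤ L
             × (∀ j k → v j ≡ v k → j ≡ k)
             × (∀ j k → CycAdj L j k → G (v j) (v k))
             × (∀ j k → G (v j) (v k) → CycAdj L j k)

module _ {n : ℕ} (D : Digraph n) {L : ℕ} (v : Fin L → Fin n) where

  indegH : Fin L → ℕ
  indegH a = count (λ b → D (v b) (v a))

  InΓ : Fin L → Set
  InΓ a = indegH a ≡ 2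

  InC : Fin n → Set
  InC x = ∃ λ a → v a ≡ x × ¬ InΓ a

  lenC : ℕ
  lenC = count (λ a → not (indegH a ≡ᵇ 2))

IsCliqueIn : ∀ {n} → (Fin n → Fin n → Set) → (Fin n → Set) → List (Fin n) → Set
IsCliqueIn G S K = Unique K × All S K × (∀ {x y} → x ∈ K → y ∈ K → x ≢ y → G x y)

HasHoleIn : ∀ {n} → (Fin n → Fin n → Set) → (Fin n → Set) → Set
HasHoleIn G S = Σ ℕ λ L → Σ (Fin L → Fin _) λ w → IsHole G L w × (∀ k → S (w k))

-- Walking along the hole H and skipping the vertices of Γ_H (no two of which are
-- consecutive, by acyclicity) traces the cycle C of P(D). Each vertex of C has an
-- out-neighbour on H, so by the out-degree bound it has at most one out-neighbour off H;
-- hence two vertices of C are adjacent in P(D) only if they are consecutive on C or share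
-- that outside out-neighbour. If no two vertices of C share one, C itself is a hole.
-- Otherwise fix such a shared outside vertex x: the vertices of C with an arc to x form a
-- clique, so by the clique bound they are too sparse to cover every other position of C,
-- and some pointer to x is followed by two non-pointers. The stretch of C from that pointer
-- to the next one, closed through x, is a cycle whose closing edge lies in no triangle,
-- and shortcutting its chords leaves a hole.

module Submission where

open import Defs
open import Data.Bool using (Bool; true; false; not; T; _∨_; if_then_else_)
open import Data.Bool.Properties using (not-injective; ¬-not) renaming (_≟_ to _≟ᵇ_)
open import Data.Empty using (⊥; ⊥-elim)
open import Data.Fin as Fin using (Fin; toℕ; inject₁)
open import Data.Fin.Properties using (toℕ-injective; toℕ-fromℕ<; toℕ<n; any?; all?) renaming (_≟_ to _≟ᶠ_)
open import Data.List using (List; []; _∷_; length)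
open import Data.List.Membership.Propositional using (_∈_)
open import Data.List.Relation.Unary.All as All using (All; []; _∷_)
open import Data.List.Relation.Unary.All.Properties using (All¬⇒¬Any)
open import Data.List.Relation.Unary.AllPairs using ([]; _∷_)
open import Data.List.Relation.Unary.Any using (here; there)
open import Data.List.Relation.Unary.Unique.Propositional using (Unique)
open import Data.Nat using (ℕ; zero; suc; _+_; _∸_; _%_; _≤_; _<_; _≤?_; _<?_; _≟_; _≡ᵇ_; z≤n; s≤s; s≤s⁻¹)
open import Data.Nat.DivMod
open import Data.Nat.Induction using (<-rec)
open import Data.Nat.Properties
open import Algebra.Properties.CommutativeSemigroup +-commutativeSemigroup using (xy∙z≈xz∙y)
open import Data.Product using (Σ; ∃; _×_; _,_; proj₁; proj₂)
open import Data.Sum using (_⊎_; inj₁; inj₂; [_,_]′)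
open import Data.Unit using (tt)
open import Data.Vec.Functional using (tail)
open import Function using (_∘_)
open import Relation.Binary.Definitions using (tri<; tri≈; tri>)
open import Relation.Binary.PropositionalEquality
open import Relation.Nullary using (¬_; Dec; yes; no; does; contradiction)
open import Relation.Nullary.Decidable using (dec-true; _×-dec_; _⊎-dec_; ¬?)

does-true : ∀ {A : Set} (a? : Dec A) → does a? ≡ true → A
does-true (yes a) _ = a

count-mono : ∀ {m} (f g : Fin m → Bool) → (∀ b → f b ≡ true → g b ≡ true) → count f ≤ count g
count-mono {zero} f g f⊆g = z≤n
count-mono {suc m} f g f⊆g with f Fin.zero in fz | g Fin.zero in gz
... | true  | true  = s≤s (count-mono (tail f) (tail g) (λ b → f⊆g (Fin.suc b)))
... | true  | false with () ← trans (sym (f⊆g Fin.zero fz)) gz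
... | false | true  = m≤n⇒m≤1+n (count-mono (tail f) (tail g) (λ b → f⊆g (Fin.suc b)))
... | false | false = count-mono (tail f) (tail g) (λ b → f⊆g (Fin.suc b))

count-∨ : ∀ {m} (f g : Fin m → Bool) → count (λ b → f b ∨ g b) ≤ count f + count g
count-∨ {zero} f g = z≤n
count-∨ {suc m} f g with f Fin.zero | g Fin.zero
... | true  | true  = s≤s (≤-trans (m≤n⇒m≤1+n (count-∨ (tail f) (tail g))) (≤-reflexive (sym (+-suc _ _))))
... | true  | false = s≤s (count-∨ (tail f) (tail g))
... | false | true  = ≤-trans (s≤s (count-∨ (tail f) (tail g))) (≤-reflexive (sym (+-suc _ _)))
... | false | false = count-∨ (tail f) (tail g)

count-∨-disjoint : ∀ {m} (f g : Fin m → Bool) → (∀ b → f b ≡ true → g b ≡ true → ⊥) →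
                   count (λ b → f b ∨ g b) ≡ count f + count g
count-∨-disjoint {zero} f g f∩g≡∅ = refl
count-∨-disjoint {suc m} f g f∩g≡∅ with f Fin.zero in fz | g Fin.zero in gz
... | true  | true  with () ← f∩g≡∅ Fin.zero fz gz
... | true  | false = cong suc (count-∨-disjoint (tail f) (tail g) (λ b → f∩g≡∅ (Fin.suc b)))
... | false | true  = trans (cong suc (count-∨-disjoint (tail f) (tail g) (λ b → f∩g≡∅ (Fin.suc b)))) (sym (+-suc _ _))
... | false | false = count-∨-disjoint (tail f) (tail g) (λ b → f∩g≡∅ (Fin.suc b))

count-false : ∀ {m} → count {m} (λ _ → false) ≡ 0
count-false {zero} = refl
count-false {suc m} = count-false {m}

count-≟ : ∀ {m} (u : Fin m) → count (λ b → does (b ≟ᶠ u)) ≡ 1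
count-≟ {suc m} Fin.zero = cong suc (count-false {m})
count-≟ (Fin.suc u) = count-≟ u

0<count⇒∃ : ∀ {m} (f : Fin m → Bool) → 0 < count f → ∃ λ b → f b ≡ true
0<count⇒∃ {suc m} f 0<count with f Fin.zero in f0
... | true  = Fin.zero , f0
... | false with 0<count⇒∃ (tail f) 0<count
...   | b , fb = Fin.suc b , fb

module _ {m : ℕ} where
  open import Data.List.Membership.DecPropositional (_≟ᶠ_ {m}) using (_∈?_)

  memberᵇ : List (Fin m) → Fin m → Bool
  memberᵇ xs b = does (b ∈? xs)

  count-memberᵇ : (xs : List (Fin m)) → count (memberᵇ xs) ≤ length xs
  count-memberᵇ [] = ≤-reflexive (count-false {m})
  count-memberᵇ (x ∷ xs) = begin
    count (memberᵇ (x ∷ xs))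
      ≤⟨ count-∨ (λ b → does (b ≟ᶠ x)) (memberᵇ xs) ⟩
    count (λ b → does (b ≟ᶠ x)) + count (memberᵇ xs)
      ≤⟨ +-mono-≤ (≤-reflexive (count-≟ x)) (count-memberᵇ xs) ⟩
    suc (length xs) ∎
    where open ≤-Reasoning

  count-memberᵇ-unique : (xs : List (Fin m)) → Unique xs → count (memberᵇ xs) ≡ length xs
  count-memberᵇ-unique [] _ = count-false {m}
  count-memberᵇ-unique (x ∷ xs) (x∉xs ∷ xs!) = begin
    count (memberᵇ (x ∷ xs))
      ≡⟨ count-∨-disjoint (λ b → does (b ≟ᶠ x)) (memberᵇ xs) disjoint ⟩
    count (λ b → does (b ≟ᶠ x)) + count (memberᵇ xs)
      ≡⟨ cong₂ _+_ (count-≟ x) (count-memberᵇ-unique xs xs!) ⟩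
    suc (length xs) ∎
    where
    open ≡-Reasoning
    disjoint : ∀ b → does (b ≟ᶠ x) ≡ true → memberᵇ xs b ≡ true → ⊥
    disjoint b b≡x b∈xs with does-true (b ≟ᶠ x) b≡x
    ... | refl = All¬⇒¬Any x∉xs (does-true (b ∈? xs) b∈xs)

  count≤length : (f : Fin m → Bool) (xs : List (Fin m)) → (∀ b → f b ≡ true → b ∈ xs) → count f ≤ length xs
  count≤length f xs covers =
    ≤-trans (count-mono f (memberᵇ xs) (λ b fb → dec-true (b ∈? xs) (covers b fb))) (count-memberᵇ xs)

  length≤count : (f : Fin m → Bool) (xs : List (Fin m)) → Unique xs → All (λ b → f b ≡ true) xs
               → length xs ≤ count f
  length≤count f xs xs! all = subst (_≤ count f) (count-memberᵇ-unique xs xs!)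
    (count-mono (memberᵇ xs) f (λ b b∈xs → All.lookup all (does-true (b ∈? xs) b∈xs)))

countBelow : (ℕ → Bool) → ℕ → ℕ
countBelow g zero    = 0
countBelow g (suc r) = (if g 0 then 1 else 0) + countBelow (g ∘ suc) r

select : ∀ {A : Set} → (ℕ → Bool) → (ℕ → A) → ℕ → List A
select g f zero = []
select g f (suc r) with g 0
... | true  = f 0 ∷ select (g ∘ suc) (f ∘ suc) r
... | false = select (g ∘ suc) (f ∘ suc) r

module _ {A : Set} where

  length-select : ∀ g (f : ℕ → A) r → length (select g f r) ≡ countBelow g r
  length-select g f zero = refl
  length-select g f (suc r) with g 0
  ... | true  = cong suc (length-select (g ∘ suc) (f ∘ suc) r)
  ... | false = length-select (g ∘ suc) (f ∘ suc) r

  ∈-select : ∀ g (f : ℕ → A) r {x} → x ∈ select g f r → ∃ λ t → t < r × g t ≡ true × x ≡ f t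
  ∈-select g f (suc r) x∈ with g 0 in g0
  ∈-select g f (suc r) (here x≡f0) | true = 0 , s≤s z≤n , g0 , x≡f0
  ∈-select g f (suc r) (there x∈) | true with ∈-select (g ∘ suc) (f ∘ suc) r x∈
  ... | t , t<r , gt , x≡ft = suc t , s≤s t<r , gt , x≡ft
  ∈-select g f (suc r) x∈ | false with ∈-select (g ∘ suc) (f ∘ suc) r x∈
  ... | t , t<r , gt , x≡ft = suc t , s≤s t<r , gt , x≡ft

  select-unique : ∀ g (f : ℕ → A) r → (∀ {i j} → i < r → j < r → f i ≡ f j → i ≡ j) → Unique (select g f r)
  select-unique g f zero f-inj = []
  select-unique g f (suc r) f-inj with g 0
  ... | true  = All.tabulate f0∉ ∷ select-unique (g ∘ suc) (f ∘ suc) r f∘suc-inj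
    where
    f∘suc-inj : ∀ {i j} → i < r → j < r → f (suc i) ≡ f (suc j) → i ≡ j
    f∘suc-inj i<r j<r eq = suc-injective (f-inj (s≤s i<r) (s≤s j<r) eq)
    f0∉ : ∀ {x} → x ∈ select (g ∘ suc) (f ∘ suc) r → f 0 ≢ x
    f0∉ x∈ f0≡x with ∈-select (g ∘ suc) (f ∘ suc) r x∈
    ... | t , t<r , _ , x≡ft with () ← f-inj (s≤s z≤n) (s≤s t<r) (trans f0≡x x≡ft)
  ... | false = select-unique (g ∘ suc) (f ∘ suc) r (λ i<r j<r eq → suc-injective (f-inj (s≤s i<r) (s≤s j<r) eq))

countBelow-true : ∀ (g : ℕ → Bool) r → g 0 ≡ true → countBelow g (suc r) ≡ suc (countBelow (g ∘ suc) r)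
countBelow-true g r g0 rewrite g0 = refl

countBelow-false : ∀ (g : ℕ → Bool) r → g 0 ≡ false → countBelow g (suc r) ≡ countBelow (g ∘ suc) r
countBelow-false g r g0 rewrite g0 = refl

Gapless : (ℕ → Bool) → ℕ → Set
Gapless g r = ∀ t → suc (suc t) < r → g t ≡ true → g (suc t) ≡ true ⊎ g (suc (suc t)) ≡ true

gapless-step : ∀ g r → g 0 ≡ true → Gapless g (3 + r)
             → (g 1 ≡ true → 2 + r ≤ countBelow (g ∘ suc) (2 + r) + countBelow (g ∘ suc) (2 + r))
             → (g 2 ≡ true → 1 + r ≤ countBelow (g ∘ suc ∘ suc) (1 + r) + countBelow (g ∘ suc ∘ suc) (1 + r))
             → 3 + r ≤ countBelow g (3 + r) + countBelow g (3 + r)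
gapless-step g r g0 gapless from-1 from-2 with g 1 ≟ᵇ true
... | yes g1 = subst (λ c → 3 + r ≤ c + c) (sym (countBelow-true g (2 + r) g0))
                 (s≤s (≤-trans (from-1 g1) (+-monoʳ-≤ c (n≤1+n c))))
  where c = countBelow (g ∘ suc) (2 + r)
... | no ¬g1 with gapless 0 (s≤s (s≤s (s≤s z≤n))) g0
...   | inj₁ g1 = contradiction g1 ¬g1
...   | inj₂ g2 = subst (λ c → 3 + r ≤ c + c) (sym (trans (countBelow-true g (2 + r) g0) (cong suc c≡d)))
                    (s≤s (subst (2 + r ≤_) (sym (+-suc d d)) (s≤s (from-2 g2))))
  where
  d = countBelow (g ∘ suc ∘ suc) (1 + r)
  c≡d : countBelow (g ∘ suc) (2 + r) ≡ d
  c≡d = countBelow-false (g ∘ suc) (1 + r) (¬-not ¬g1)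

gapless⇒dense : ∀ g r → g 0 ≡ true → Gapless g r → r ≤ countBelow g r + countBelow g r
gapless⇒dense g zero             g0 gapless = z≤n
gapless⇒dense g (suc zero)       g0 gapless = subst (λ c → 1 ≤ c + c) (sym (countBelow-true g 0 g0)) (s≤s z≤n)
gapless⇒dense g (suc (suc zero)) g0 gapless =
  subst (λ c → 2 ≤ c + c) (sym (countBelow-true g 1 g0)) (s≤s (≤-trans (s≤s z≤n) (m≤n+m _ _)))
gapless⇒dense g (suc (suc (suc r))) g0 gapless = gapless-step g r g0 gapless
  (λ g1 → gapless⇒dense (g ∘ suc) (suc (suc r)) g1 (λ t lt → gapless (suc t) (s≤s lt)))
  (λ g2 → gapless⇒dense (g ∘ suc ∘ suc) (suc r) g2 (λ t lt → gapless (suc (suc t)) (s≤s (s≤s lt))))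

least-true : ∀ (g : ℕ → Bool) r → g r ≡ true → ∃ λ u → u ≤ r × g u ≡ true × (∀ t → t < u → g t ≡ false)
least-true g zero gr = 0 , z≤n , gr , λ _ ()
least-true g (suc r) gr with g 0 in g0
... | true  = 0 , z≤n , g0 , λ _ ()
... | false with least-true (g ∘ suc) r gr
...   | u , u≤r , gu , before = suc u , s≤s u≤r , gu , below
  where
  below : ∀ t → t < suc u → g t ≡ false
  below zero    _       = g0
  below (suc t) 1+t<1+u = before t (s≤s⁻¹ 1+t<1+u)

skip : ℕ → ℕ → ℕ → ℕ
skip j d i with i ≤? j
... | yes _ = i
... | no  _ = i + d

skip-≤ : ∀ j d {i} → i ≤ j → skip j d i ≡ i
skip-≤ j d {i} i≤j with i ≤? j
... | yes _ = refl
... | no i≰j = contradiction i≤j i≰j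

skip-> : ∀ j d {i} → j < i → skip j d i ≡ i + d
skip-> j d {i} j<i with i ≤? j
... | yes i≤j = contradiction i≤j (<⇒≱ j<i)
... | no  _   = refl

i≤skip : ∀ j d i → i ≤ skip j d i
i≤skip j d i with i ≤? j
... | yes _ = ≤-refl
... | no  _ = m≤m+n i d

skip-strictlyIncreasing : ∀ j d {i i′} → i < i′ → skip j d i < skip j d i′
skip-strictlyIncreasing j d {i} {i′} i<i′ with i ≤? j | i′ ≤? j
... | yes _   | yes _    = i<i′
... | yes _   | no  _    = <-≤-trans i<i′ (m≤m+n i′ d)
... | no  i≰j | yes i′≤j = contradiction (≤-trans (<⇒≤ i<i′) i′≤j) i≰j
... | no  _   | no  _    = +-monoˡ-< d i<i′

skip-injective : ∀ j d {i i′} → skip j d i ≡ skip j d i′ → i ≡ i′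
skip-injective j d {i} {i′} eq with <-cmp i i′
... | tri< i<i′ _ _ = contradiction eq (<⇒≢ (skip-strictlyIncreasing j d i<i′))
... | tri≈ _ i≡i′ _ = i≡i′
... | tri> _ _ i>i′ = contradiction (sym eq) (<⇒≢ (skip-strictlyIncreasing j d i>i′))

shortcut-length : ∀ j e r → suc (j + r) + suc e ≡ 2 + j + e + r
shortcut-length j e r = cong suc (trans (+-suc (j + r) e) (cong suc (xy∙z≈xz∙y j r e)))

2≤1+j+r : ∀ j r → ¬ (j ≡ 0 × r ≡ 0) → 2 ≤ suc (j + r)
2≤1+j+r zero    zero    not-both = contradiction (refl , refl) not-both
2≤1+j+r zero    (suc r) _        = s≤s (s≤s z≤n)
2≤1+j+r (suc j) r       _        = s≤s (s≤s z≤n)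

module HoleFromCycle {n : ℕ} (G : Fin n → Fin n → Set) (S : Fin n → Set)
  (G? : ∀ x y → Dec (G x y)) (G-sym : ∀ {x y} → G x y → G y x) (G-irrefl : ∀ {x} → ¬ G x x) where

  record Cycle (k : ℕ) (y : ℕ → Fin n) : Set where
    field
      injective         : ∀ i j → i ≤ k → j ≤ k → y i ≡ y j → i ≡ j
      adjacent          : ∀ i → i < k → G (y i) (y (suc i))
      closing           : G (y 0) (y k)
      closing-triangle-free : ∀ i → 0 < i → i < k → G (y 0) (y i) → G (y i) (y k) → ⊥
      inside            : ∀ i → i ≤ k → S (y i)
  open Cycle

  Chord : ℕ → (ℕ → Fin n) → ℕ → ℕ → Set
  Chord k y j j′ = 2 + j ≤ j′ × ¬ (j ≡ 0 × j′ ≡ k) × G (y j) (y j′)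

  chord? : ∀ k y j j′ → Dec (Chord k y j j′)
  chord? k y j j′ = (2 + j ≤? j′) ×-dec ¬? ((j ≟ 0) ×-dec (j′ ≟ k)) ×-dec G? (y j) (y j′)

  no-chord⇒hole : ∀ k y → 3 ≤ k → Cycle k y → (∀ j j′ → j′ ≤ k → ¬ Chord k y j j′) → HasHoleIn G S
  no-chord⇒hole k y 3≤k c chordless =
    suc k , w , (s≤s 3≤k , w-injective , adjacent⇒edge , edge⇒adjacent) , λ j → inside c (toℕ j) (bounded j)
    where
    w : Fin (suc k) → Fin n
    w j = y (toℕ j)
    bounded : (j : Fin (suc k)) → toℕ j ≤ k
    bounded j = s≤s⁻¹ (toℕ<n j)
    w-injective : ∀ j j′ → w j ≡ w j′ → j ≡ j′
    w-injective j j′ eq = toℕ-injective (injective c (toℕ j) (toℕ j′) (bounded j) (bounded j′) eq)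
    step : ∀ {i j} → suc i ≡ j → j ≤ k → G (y i) (y j)
    step {i} refl j≤k = adjacent c i j≤k
    adjacent⇒edge : ∀ j j′ → CycAdj (suc k) j j′ → G (w j) (w j′)
    adjacent⇒edge j j′ (inj₁ eq)                          = step eq (bounded j′)
    adjacent⇒edge j j′ (inj₂ (inj₁ eq))                   = G-sym (step eq (bounded j))
    adjacent⇒edge j j′ (inj₂ (inj₂ (inj₁ (j≡0 , j′≡k)))) rewrite j≡0 | suc-injective j′≡k = closing c
    adjacent⇒edge j j′ (inj₂ (inj₂ (inj₂ (j′≡0 , j≡k)))) rewrite j′≡0 | suc-injective j≡k = G-sym (closing c)
    ordered : ∀ {a b} → a < b → b ≤ k → G (y a) (y b) → suc a ≡ b ⊎ (a ≡ 0 × b ≡ k)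
    ordered {a} {b} a<b b≤k g with m≤n⇒m<n∨m≡n a<b | a ≟ 0 ×-dec b ≟ k
    ... | inj₂ 1+a≡b | _          = inj₁ 1+a≡b
    ... | inj₁ 1+a<b | yes ends   = inj₂ ends
    ... | inj₁ 1+a<b | no  ¬ends  = ⊥-elim (chordless a b b≤k (1+a<b , ¬ends , g))
    edge⇒adjacent : ∀ j j′ → G (w j) (w j′) → CycAdj (suc k) j j′
    edge⇒adjacent j j′ g with <-cmp (toℕ j) (toℕ j′)
    ... | tri≈ _ j≡j′ _ = ⊥-elim (G-irrefl (subst (λ t → G (w j) (y t)) (sym j≡j′) g))
    ... | tri< j<j′ _ _ with ordered j<j′ (bounded j′) g
    ...   | inj₁ eq            = inj₁ eq
    ...   | inj₂ (j≡0 , j′≡k)  = inj₂ (inj₂ (inj₁ (j≡0 , cong suc j′≡k)))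
    edge⇒adjacent j j′ g | tri> _ _ j′<j with ordered j′<j (bounded j) (G-sym g)
    ...   | inj₁ eq            = inj₂ (inj₁ eq)
    ...   | inj₂ (j′≡0 , j≡k)  = inj₂ (inj₂ (inj₂ (j′≡0 , cong suc j≡k)))

  shortcut : ∀ j e r y → Cycle (2 + j + e + r) y → ¬ (j ≡ 0 × r ≡ 0) → G (y j) (y (2 + j + e))
           → Cycle (suc (j + r)) (λ i → y (skip j (suc e) i))
  shortcut j e r y c not-closing chord = record
    { injective             = λ i i′ i≤ i′≤ eq → skip-injective j (suc e) (injective c _ _ (bound i≤) (bound i′≤) eq)
    ; adjacent              = adjacent′
    ; closing               = subst₂ (λ a b → G (y a) (y b)) (sym s0) (sym send) (closing c)
    ; closing-triangle-free = triangle-free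
    ; inside                = λ i i≤ → inside c _ (bound i≤)
    }
    where
    k k′ : ℕ
    k  = 2 + j + e + r
    k′ = suc (j + r)
    s : ℕ → ℕ
    s = skip j (suc e)
    k′+1+e≡k : k′ + suc e ≡ k
    k′+1+e≡k = shortcut-length j e r
    s0 : s 0 ≡ 0
    s0 = skip-≤ j (suc e) z≤n
    send : s k′ ≡ k
    send = trans (skip-> j (suc e) (s≤s (m≤m+n j r))) k′+1+e≡k
    bound : ∀ {i} → i ≤ k′ → s i ≤ k
    bound {i} i≤k′ = subst (s i ≤_) send (skip-monotone i≤k′)
      where
      skip-monotone : ∀ {i i′} → i ≤ i′ → s i ≤ s i′
      skip-monotone i≤i′ with m≤n⇒m<n∨m≡n i≤i′
      ... | inj₁ i<i′ = <⇒≤ (skip-strictlyIncreasing j (suc e) i<i′)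
      ... | inj₂ refl = ≤-refl
    adjacent′ : ∀ i → i < k′ → G (y (s i)) (y (s (suc i)))
    adjacent′ i i<k′ with <-cmp i j
    ... | tri< i<j _ _ rewrite skip-≤ j (suc e) (<⇒≤ i<j) | skip-≤ j (suc e) i<j =
          adjacent c i (≤-trans i<k′ (≤-trans (m≤m+n k′ (suc e)) (≤-reflexive k′+1+e≡k)))
    ... | tri≈ _ refl _ rewrite skip-≤ j (suc e) ≤-refl | skip-> j (suc e) ≤-refl =
          subst (λ t → G (y j) (y t)) (sym (+-suc (suc j) e)) chord
    ... | tri> _ _ j<i rewrite skip-> j (suc e) j<i | skip-> j (suc e) (m<n⇒m<1+n j<i) =
          adjacent c (i + suc e) (≤-trans (+-monoˡ-≤ (suc e) i<k′) (≤-reflexive k′+1+e≡k))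
    triangle-free : ∀ i → 0 < i → i < k′ → G (y (s 0)) (y (s i)) → G (y (s i)) (y (s k′)) → ⊥
    triangle-free i 0<i i<k′ rewrite s0 | send =
      closing-triangle-free c (s i) (<-≤-trans 0<i (i≤skip j (suc e) i))
        (subst (s i <_) send (skip-strictlyIncreasing j (suc e) i<k′))

  not-triangle : ∀ y → ¬ Cycle 2 y
  not-triangle y c = closing-triangle-free c 1 (s≤s z≤n) (s≤s (s≤s z≤n)) (adjacent c 0 (s≤s z≤n)) (adjacent c 1 ≤-refl)

  3≤length : ∀ {k y} → Cycle k y → 2 ≤ k → 3 ≤ k
  3≤length {y = y} c 2≤k with m≤n⇒m<n∨m≡n 2≤k
  ... | inj₁ 3≤k  = 3≤k
  ... | inj₂ refl = contradiction c (not-triangle y)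

  -- Shortcut chords until none is left: the closing edge survives every shortcut, and
  -- since it lies in no triangle the cycle never collapses to a triangle.
  hole-from-cycle : ∀ k y → 3 ≤ k → Cycle k y → HasHoleIn G S
  hole-from-cycle = <-rec (λ k → ∀ y → 3 ≤ k → Cycle k y → HasHoleIn G S) from-shorter
    where
    from-shorter : ∀ k → (∀ {k′} → k′ < k → ∀ y → 3 ≤ k′ → Cycle k′ y → HasHoleIn G S)
                 → ∀ y → 3 ≤ k → Cycle k y → HasHoleIn G S
    from-shorter k shorter y 3≤k c with anyUpTo? (λ j′ → anyUpTo? (λ j → chord? k y j j′) j′) (suc k)
    ... | no ∄chord = no-chord⇒hole k y 3≤k c
          (λ j j′ j′≤k ch → ∄chord (j′ , s≤s j′≤k , j , ≤-trans (n≤1+n (suc j)) (proj₁ ch) , ch))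
    ... | yes (_ , j′<1+k , j , _ , 2+j≤j′ , not-closing , g)
      with m≤n⇒∃[o]m+o≡n 2+j≤j′
    ... | e , refl with m≤n⇒∃[o]m+o≡n (s≤s⁻¹ j′<1+k)
    ... | r , refl = shorter shorter-length _ (3≤length c′ (2≤1+j+r j r not-closing′)) c′
      where
      not-closing′ : ¬ (j ≡ 0 × r ≡ 0)
      not-closing′ (j≡0 , r≡0) = not-closing (j≡0 , trans (sym (+-identityʳ _)) (cong (2 + j + e +_) (sym r≡0)))
      c′ = shortcut j e r y c not-closing′ g
      shorter-length : suc (j + r) < 2 + j + e + r
      shorter-length = subst (suc (j + r) <_) (shortcut-length j e r) (m<m+n _ (s≤s z≤n))

module _ {n : ℕ} (D : Digraph n) where

  acyclic⇒irreflexive : Acyclic D → ∀ {x} → ¬ Arc D x x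
  acyclic⇒irreflexive acyclic {x} x→x = acyclic 0 (λ _ → x) (λ _ → x→x) refl

  acyclic⇒asymmetric : Acyclic D → ∀ {x y} → Arc D x y → ¬ Arc D y x
  acyclic⇒asymmetric acyclic {x} {y} x→y y→x = acyclic 1 walk arcs refl
    where
    walk : Fin 3 → Fin n
    walk Fin.zero                     = x
    walk (Fin.suc Fin.zero)           = y
    walk (Fin.suc (Fin.suc Fin.zero)) = x
    arcs : (j : Fin 2) → Arc D (walk (inject₁ j)) (walk (Fin.suc j))
    arcs Fin.zero           = x→y
    arcs (Fin.suc Fin.zero) = y→x

  outdeg≤2⇒¬3-out-neighbours : ∀ {u x y z} → outdeg D u ≤ 2 → Arc D u x → Arc D u y → Arc D u z
                             → x ≢ y → x ≢ z → y ≢ z → ⊥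
  outdeg≤2⇒¬3-out-neighbours {u} {x} {y} {z} outdeg≤2 u→x u→y u→z x≢y x≢z y≢z =
    <-irrefl refl (≤-trans (length≤count (D u) (x ∷ y ∷ z ∷ []) distinct (u→x ∷ u→y ∷ u→z ∷ [])) outdeg≤2)
    where
    distinct : Unique (x ∷ y ∷ z ∷ [])
    distinct = (x≢y ∷ x≢z ∷ []) ∷ (y≢z ∷ []) ∷ [] ∷ []

  PEdge-sym : ∀ {x y} → PEdge D x y → PEdge D y x
  PEdge-sym (x≢y , inj₁ x→y)                = ≢-sym x≢y , inj₂ (inj₁ x→y)
  PEdge-sym (x≢y , inj₂ (inj₁ y→x))         = ≢-sym x≢y , inj₁ y→x
  PEdge-sym (x≢y , inj₂ (inj₂ (w , x→w , y→w))) = ≢-sym x≢y , inj₂ (inj₂ (w , y→w , x→w))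

  PEdge-irrefl : ∀ {x} → ¬ PEdge D x x
  PEdge-irrefl (x≢x , _) = x≢x refl

  PEdge? : ∀ x y → Dec (PEdge D x y)
  PEdge? x y = ¬? (x ≟ᶠ y)
          ×-dec (D x y ≟ᵇ true ⊎-dec D y x ≟ᵇ true ⊎-dec any? (λ w → D x w ≟ᵇ true ×-dec D y w ≟ᵇ true))

-- Positions on H are natural numbers read modulo L, so moving along H needs no
-- wrap-around case split.
module Cyclic (L₀ : ℕ) where

  L : ℕ
  L = suc L₀

  infix 4 _≈_
  record _≈_ (p q : ℕ) : Set where
    constructor mod-≡
    field %-≡ : p % L ≡ q % L
  open _≈_ public

  ≈-refl : ∀ {p} → p ≈ p
  ≈-refl = mod-≡ refl

  ≈-reflexive : ∀ {p q} → p ≡ q → p ≈ q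
  ≈-reflexive refl = ≈-refl

  ≈-sym : ∀ {p q} → p ≈ q → q ≈ p
  ≈-sym (mod-≡ eq) = mod-≡ (sym eq)

  ≈-trans : ∀ {p q r} → p ≈ q → q ≈ r → p ≈ r
  ≈-trans (mod-≡ eq) (mod-≡ eq′) = mod-≡ (trans eq eq′)

  %≈ : ∀ p → p % L ≈ p
  %≈ p = mod-≡ (m%n%n≡m%n p L)

  +L≈ : ∀ p → p + L ≈ p
  +L≈ p = mod-≡ ([m+n]%n≡m%n p L)

  ≈-+ʳ : ∀ {p q} c → p ≈ q → p + c ≈ q + c
  ≈-+ʳ {p} {q} c (mod-≡ eq) = mod-≡ (begin
    (p + c) % L               ≡⟨ %-distribˡ-+ p c L ⟩
    (p % L + c % L) % L       ≡⟨ cong (λ t → (t + c % L) % L) eq ⟩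
    (q % L + c % L) % L       ≡⟨ %-distribˡ-+ q c L ⟨
    (q + c) % L               ∎)
    where open ≡-Reasoning

  ≈-suc : ∀ {p q} → p ≈ q → suc p ≈ suc q
  ≈-suc {p} {q} eq = subst₂ _≈_ (+-comm p 1) (+-comm q 1) (≈-+ʳ 1 eq)

  1+[p+L₀]≈p : ∀ p → suc (p + L₀) ≈ p
  1+[p+L₀]≈p p = subst (_≈ p) (+-suc p L₀) (+L≈ p)

  ≈-pred : ∀ {p q} → suc p ≈ suc q → p ≈ q
  ≈-pred {p} {q} eq = ≈-trans (≈-sym (1+[p+L₀]≈p p)) (≈-trans (≈-+ʳ L₀ eq) (1+[p+L₀]≈p q))

  [a%L+e]%L≡[a+e]%L : ∀ a e → e < L → (a % L + e) % L ≡ (a + e) % L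
  [a%L+e]%L≡[a+e]%L a e e<L = begin
    (a % L + e) % L         ≡⟨ cong (λ x → (a % L + x) % L) (m<n⇒m%n≡m e<L) ⟨
    (a % L + e % L) % L     ≡⟨ %-distribˡ-+ a e L ⟨
    (a + e) % L             ∎
    where open ≡-Reasoning

  ≈-offset : ∀ a e → a + e ≈ a → e < L → e ≡ 0
  ≈-offset a e (mod-≡ eq) e<L with a % L + e <? L
  ... | yes t+e<L = +-cancelˡ-≡ t e 0 (begin
          t + e          ≡⟨ m<n⇒m%n≡m t+e<L ⟨
          (t + e) % L    ≡⟨ trans ([a%L+e]%L≡[a+e]%L a e e<L) eq ⟩
          t              ≡⟨ +-identityʳ t ⟨
          t + 0          ∎)
    where open ≡-Reasoning
          t = a % L
  ... | no  t+e≮L = contradiction e≡L (<⇒≢ e<L)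
    where
    open ≡-Reasoning
    t = a % L
    L≤t+e : L ≤ t + e
    L≤t+e = ≮⇒≥ t+e≮L
    t+e∸L<L : t + e ∸ L < L
    t+e∸L<L = +-cancelʳ-< _ _ L (subst (_< L + L) (sym (m∸n+n≡m L≤t+e)) (+-mono-< (m%n<n a L) e<L))
    e≡L : e ≡ L
    e≡L = +-cancelˡ-≡ t e L (begin
      t + e              ≡⟨ m∸n+n≡m L≤t+e ⟨
      t + e ∸ L + L      ≡⟨ cong (_+ L) (m<n⇒m%n≡m t+e∸L<L) ⟨
      (t + e ∸ L) % L + L ≡⟨ cong (_+ L) (m≤n⇒[n∸m]%m≡n%m L≤t+e) ⟩
      (t + e) % L + L    ≡⟨ cong (_+ L) (trans ([a%L+e]%L≡[a+e]%L a e e<L) eq) ⟩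
      t + L              ∎)

  toℕ-mod : ∀ p → toℕ (p mod L) ≡ p % L
  toℕ-mod p = toℕ-fromℕ< (m%n<n p L)

  mod-cong : ∀ {p q} → p ≈ q → p mod L ≡ q mod L
  mod-cong {p} {q} (mod-≡ eq) = toℕ-injective (trans (toℕ-mod p) (trans eq (sym (toℕ-mod q))))

  mod-injective : ∀ {p q} → p mod L ≡ q mod L → p ≈ q
  mod-injective {p} {q} eq = mod-≡ (trans (sym (toℕ-mod p)) (trans (cong toℕ eq) (toℕ-mod q)))

  toℕ-mod-inverse : (b : Fin L) → toℕ b mod L ≡ b
  toℕ-mod-inverse b = toℕ-injective (trans (toℕ-mod (toℕ b)) (m<n⇒m%n≡m (toℕ<n b)))

  1+[p%L]≈1+p : ∀ p → suc (p % L) ≈ suc p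
  1+[p%L]≈1+p p = ≈-suc (%≈ p)

  CycAdj-suc : ∀ p → CycAdj L (p mod L) (suc p mod L)
  CycAdj-suc p rewrite toℕ-mod p | toℕ-mod (suc p) with suc (p % L) <? L
  ... | yes 1+p%L<L = inj₁ (trans (sym (m<n⇒m%n≡m 1+p%L<L)) (%-≡ (1+[p%L]≈1+p p)))
  ... | no  1+p%L≮L = inj₂ (inj₂ (inj₂ ([1+p]%L≡0 , 1+p%L≡L)))
    where
    1+p%L≡L : suc (p % L) ≡ L
    1+p%L≡L = ≤-antisym (m%n<n p L) (≮⇒≥ 1+p%L≮L)
    [1+p]%L≡0 : suc p % L ≡ 0
    [1+p]%L≡0 = trans (sym (%-≡ (1+[p%L]≈1+p p))) (trans (cong (_% L) 1+p%L≡L) (n%n≡0 L))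

  wrap : ∀ {s t} → s ≡ L → t ≡ 0 → s ≈ t
  wrap refl refl = +L≈ 0

  suc-via-% : ∀ a b → suc (a % L) ≈ b % L → suc a ≈ b
  suc-via-% a b eq = ≈-trans (≈-sym (1+[p%L]≈1+p a)) (≈-trans eq (%≈ b))

  CycAdj⇒≈suc : ∀ p q → CycAdj L (p mod L) (q mod L) → suc p ≈ q ⊎ suc q ≈ p
  CycAdj⇒≈suc p q adj rewrite toℕ-mod p | toℕ-mod q with adj
  ... | inj₁ eq                         = inj₁ (suc-via-% p q (≈-reflexive eq))
  ... | inj₂ (inj₁ eq)                  = inj₂ (suc-via-% q p (≈-reflexive eq))
  ... | inj₂ (inj₂ (inj₁ (p≡0 , q≡L))) = inj₂ (suc-via-% q p (wrap q≡L p≡0))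
  ... | inj₂ (inj₂ (inj₂ (q≡0 , p≡L))) = inj₁ (suc-via-% p q (wrap p≡L q≡0))

module OnHole {n : ℕ} (D : Digraph n) (L₀ : ℕ) (v : Fin (suc L₀) → Fin n)
  (acyclic : Acyclic D) (outdeg≤2 : ∀ u → outdeg D u ≤ 2)
  (hole : IsHole (UEdge D) (suc L₀) v) (5≤L : 5 ≤ suc L₀) where

  open Cyclic L₀ public

  V : ℕ → Fin n
  V p = v (p mod L)

  V-cong : ∀ {p q} → p ≈ q → V p ≡ V q
  V-cong p≈q = cong v (mod-cong p≈q)

  V-injective : ∀ {p q} → V p ≡ V q → p ≈ q
  V-injective eq = mod-injective (proj₁ (proj₂ hole) _ _ eq)

  V-toℕ : (b : Fin L) → V (toℕ b) ≡ v b
  V-toℕ b = cong v (toℕ-mod-inverse b)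

  hole-edge : ∀ p → UEdge D (V p) (V (suc p))
  hole-edge p = proj₁ (proj₂ (proj₂ hole)) _ _ (CycAdj-suc p)

  arc⇒consecutive : ∀ {p q} → Arc D (V p) (V q) → suc p ≈ q ⊎ suc q ≈ p
  arc⇒consecutive {p} {q} p→q = CycAdj⇒≈suc p q (proj₂ (proj₂ (proj₂ hole)) _ _ (p≢q , inj₁ p→q))
    where
    p≢q : V p ≢ V q
    p≢q eq = acyclic⇒irreflexive D acyclic (subst (λ t → Arc D (V p) t) (sym eq) p→q)

  p≉2+p : ∀ p → ¬ (p ≈ 2 + p)
  p≉2+p p eq with ≈-offset p 2 (≈-sym (subst (p ≈_) (+-comm 2 p) eq)) (≤-trans (s≤s (s≤s (s≤s z≤n))) 5≤L)
  ... | ()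

  -- V p lies on C = V(H) − Γ_H; phrased exactly as the predicate counted by lenC.
  onC : ℕ → Bool
  onC p = not (indegH D v (p mod L) ≡ᵇ 2)

  onC-cong : ∀ {p q} → p ≈ q → onC p ≡ onC q
  onC-cong {p} {q} p≈q = cong (λ a → not (indegH D v a ≡ᵇ 2)) (mod-cong {p} {q} p≈q)

  onC⇒∉Γ : ∀ {p} → onC p ≡ true → ¬ InΓ D v (p mod L)
  onC⇒∉Γ onC-p p∈Γ with () ← trans (sym (cong (λ d → not (d ≡ᵇ 2)) p∈Γ)) onC-p

  ¬onC⇒∈Γ : ∀ {p} → onC p ≡ false → InΓ D v (p mod L)
  ¬onC⇒∈Γ ¬onC-p = ≡ᵇ⇒≡ _ 2 (subst T (sym (not-injective ¬onC-p)) tt)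

  ∈Γ⇒¬onC : ∀ {p} → InΓ D v (p mod L) → onC p ≡ false
  ∈Γ⇒¬onC {p} p∈Γ with onC p in onC-p
  ... | true  = contradiction p∈Γ (onC⇒∉Γ {p} onC-p)
  ... | false = refl

  in-neighbour-of-1+p : ∀ p b → Arc D (v b) (V (suc p)) → b ≡ p mod L ⊎ b ≡ (2 + p) mod L
  in-neighbour-of-1+p p b b→ with arc⇒consecutive {toℕ b} {suc p} (subst (λ x → Arc D x (V (suc p))) (sym (V-toℕ b)) b→)
  ... | inj₁ 1+b≈1+p = inj₁ (trans (sym (toℕ-mod-inverse b)) (mod-cong (≈-pred 1+b≈1+p)))
  ... | inj₂ 2+p≈b   = inj₂ (trans (sym (toℕ-mod-inverse b)) (mod-cong (≈-sym 2+p≈b)))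

  in-arcs : ℕ → Fin L → Bool
  in-arcs q b = D (v b) (V q)

  ∈Γ⇒¬unique-in-neighbour : ∀ q u → InΓ D v (q mod L) → ¬ (∀ b → Arc D (v b) (V q) → b ≡ u)
  ∈Γ⇒¬unique-in-neighbour q u q∈Γ only-u =
    <⇒≱ (≤-reflexive (sym q∈Γ)) (count≤length (in-arcs q) (u ∷ []) (λ b b→ → here (only-u b b→)))

  ∈Γ⇒arcs : ∀ p → InΓ D v (suc p mod L) → Arc D (V p) (V (suc p)) × Arc D (V (2 + p)) (V (suc p))
  ∈Γ⇒arcs p 1+p∈Γ with D (V p) (V (suc p)) in p→ | D (V (2 + p)) (V (suc p)) in 2+p→
  ... | true  | true  = refl , refl
  ... | false | _     = contradiction only-2+p (∈Γ⇒¬unique-in-neighbour (suc p) _ 1+p∈Γ)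
    where
    only-2+p : ∀ b → Arc D (v b) (V (suc p)) → b ≡ (2 + p) mod L
    only-2+p b b→ with in-neighbour-of-1+p p b b→
    ... | inj₁ refl with () ← trans (sym p→) b→
    ... | inj₂ eq = eq
  ... | true  | false = contradiction only-p (∈Γ⇒¬unique-in-neighbour (suc p) _ 1+p∈Γ)
    where
    only-p : ∀ b → Arc D (v b) (V (suc p)) → b ≡ p mod L
    only-p b b→ with in-neighbour-of-1+p p b b→
    ... | inj₁ eq = eq
    ... | inj₂ refl with () ← trans (sym 2+p→) b→

  arcs⇒∈Γ : ∀ p → Arc D (V p) (V (suc p)) → Arc D (V (2 + p)) (V (suc p)) → InΓ D v (suc p mod L)
  arcs⇒∈Γ p p→ 2+p→ = ≤-antisym (count≤length (in-arcs (suc p)) (p mod L ∷ (2 + p) mod L ∷ []) covered)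
                                 (length≤count (in-arcs (suc p)) (p mod L ∷ (2 + p) mod L ∷ []) distinct (p→ ∷ 2+p→ ∷ []))
    where
    covered : ∀ b → Arc D (v b) (V (suc p)) → b ∈ p mod L ∷ (2 + p) mod L ∷ []
    covered b b→ with in-neighbour-of-1+p p b b→
    ... | inj₁ eq = here eq
    ... | inj₂ eq = there (here eq)
    distinct : Unique (p mod L ∷ (2 + p) mod L ∷ [])
    distinct = ((λ eq → p≉2+p p (mod-injective eq)) ∷ []) ∷ [] ∷ []

  Γ-isolated : ∀ p → onC (suc p) ≡ false → onC (2 + p) ≡ true
  Γ-isolated p ¬onC-1+p with onC (2 + p) in onC-2+p
  ... | true  = refl
  ... | false = contradiction (proj₁ (∈Γ⇒arcs (suc p) (¬onC⇒∈Γ {2 + p} onC-2+p)))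
                  (acyclic⇒asymmetric D acyclic (proj₂ (∈Γ⇒arcs p (¬onC⇒∈Γ {suc p} ¬onC-1+p))))

  hole-arc : ∀ p → Arc D (V p) (V (suc p)) ⊎ Arc D (V (suc p)) (V p)
  hole-arc p = proj₂ (hole-edge p)

  onC⇒hole-out-neighbour : ∀ p → onC p ≡ true → Arc D (V p) (V (suc p)) ⊎ Arc D (V p) (V (p + L₀))
  onC⇒hole-out-neighbour p onC-p with D (V p) (V (suc p)) in p→1+p | D (V p) (V (p + L₀)) in p→p-1
  ... | true  | _     = inj₁ refl
  ... | false | true  = inj₂ refl
  ... | false | false = contradiction p∈Γ (onC⇒∉Γ {p} onC-p)
    where
    q = p + L₀
    1+q≈p : suc q ≈ p
    1+q≈p = 1+[p+L₀]≈p p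
    1+p→p : Arc D (V (suc p)) (V p)
    1+p→p with hole-arc p
    ... | inj₁ p→1+p′ with () ← trans (sym p→1+p) p→1+p′
    ... | inj₂ 1+p→p = 1+p→p
    q→1+q : Arc D (V q) (V (suc q))
    q→1+q with hole-arc q
    ... | inj₁ q→1+q = q→1+q
    ... | inj₂ 1+q→q with () ← trans (sym p→p-1) (subst (λ x → Arc D x (V q)) (V-cong 1+q≈p) 1+q→q)
    p∈Γ : InΓ D v (p mod L)
    p∈Γ = subst (InΓ D v) (mod-cong 1+q≈p)
            (arcs⇒∈Γ q q→1+q (subst₂ (Arc D) (sym (V-cong (≈-suc 1+q≈p))) (sym (V-cong 1+q≈p)) 1+p→p))

  Outside : Fin n → Set
  Outside x = ∀ b → v b ≢ x

  outside-out-neighbour-unique : ∀ p {x y} → onC p ≡ true → Arc D (V p) x → Arc D (V p) y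
                               → Outside x → Outside y → x ≡ y
  outside-out-neighbour-unique p {x} {y} onC-p p→x p→y out-x out-y with x ≟ᶠ y
  ... | yes x≡y = x≡y
  ... | no  x≢y = [ no-third (suc p) , no-third (p + L₀) ]′ (onC⇒hole-out-neighbour p onC-p)
    where
    no-third : ∀ q → Arc D (V p) (V q) → x ≡ y
    no-third q p→z = ⊥-elim (outdeg≤2⇒¬3-out-neighbours D (outdeg≤2 (V p)) p→x p→y p→z x≢y
                               (λ x≡z → out-x _ (sym x≡z)) (λ y≡z → out-y _ (sym y≡z)))

  -- By Γ-isolated, next p is the successor of p on C, so walk a i is the position reached
  -- from a after i steps along C.
  stride : ℕ → ℕ
  stride p = if onC (suc p) then 1 else 2

  next : ℕ → ℕ
  next p = p + stride p

  offset : ℕ → ℕ → ℕ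
  offset a zero    = 0
  offset a (suc i) = offset a i + stride (a + offset a i)

  walk : ℕ → ℕ → ℕ
  walk a i = a + offset a i

  walk-suc : ∀ a i → walk a (suc i) ≡ next (walk a i)
  walk-suc a i = sym (+-assoc a (offset a i) _)

  onC-next : ∀ p → onC (next p) ≡ true
  onC-next p with onC (suc p) in onC-1+p
  ... | true  = trans (cong onC (+-comm p 1)) onC-1+p
  ... | false = trans (cong onC (+-comm p 2)) (Γ-isolated p onC-1+p)

  onC-walk : ∀ a → onC a ≡ true → ∀ i → onC (walk a i) ≡ true
  onC-walk a onC-a zero    = trans (cong onC (+-identityʳ a)) onC-a
  onC-walk a onC-a (suc i) = trans (cong onC (walk-suc a i)) (onC-next (walk a i))

  PEdge-next : ∀ p → PEdge D (V p) (V (next p))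
  PEdge-next p with onC (suc p) in onC-1+p
  ... | true  rewrite +-comm p 1 = proj₁ (hole-edge p) , [ inj₁ , inj₂ ∘ inj₁ ]′ (hole-arc p)
  ... | false rewrite +-comm p 2 =
          (λ eq → p≉2+p p (V-injective eq)) , inj₂ (inj₂ (V (suc p) , ∈Γ⇒arcs p (¬onC⇒∈Γ {suc p} onC-1+p)))

  offset-suc : ∀ a i → offset a i < offset a (suc i)
  offset-suc a i with onC (suc (a + offset a i))
  ... | true  = ≤-reflexive (+-comm 1 (offset a i))
  ... | false = ≤-trans (n≤1+n _) (≤-reflexive (+-comm 2 (offset a i)))

  offset-strictlyIncreasing : ∀ a {i j} → i < j → offset a i < offset a j
  offset-strictlyIncreasing a {i} {suc j} i<1+j with m≤n⇒m<n∨m≡n (s≤s⁻¹ i<1+j)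
  ... | inj₁ i<j  = <-trans (offset-strictlyIncreasing a i<j) (offset-suc a j)
  ... | inj₂ refl = offset-suc a i

  i≤offset : ∀ a i → i ≤ offset a i
  i≤offset a zero    = z≤n
  i≤offset a (suc i) = <-≤-trans (s≤s (i≤offset a i)) (offset-suc a i)

  offset-+ : ∀ a i j → offset a (i + j) ≡ offset a i + offset (walk a i) j
  offset-+ a i zero rewrite +-identityʳ i = sym (+-identityʳ (offset a i))
  offset-+ a i (suc j) rewrite +-suc i j | offset-+ a i j =
    trans (cong (λ t → offset a i + offset (walk a i) j + stride t) (sym (+-assoc a (offset a i) _)))
          (+-assoc (offset a i) (offset (walk a i) j) _)

  walk-+ : ∀ a i j → walk a (i + j) ≡ walk (walk a i) j
  walk-+ a i j = trans (cong (a +_) (offset-+ a i j)) (sym (+-assoc a (offset a i) _))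

  offset-cong : ∀ {p q} → p ≈ q → ∀ i → offset p i ≡ offset q i
  offset-cong p≈q zero    = refl
  offset-cong {p} {q} p≈q (suc i) rewrite offset-cong p≈q i =
    cong (λ b → offset q i + (if b then 1 else 2)) (onC-cong (≈-suc (≈-+ʳ (offset q i) p≈q)))

  walk-cong : ∀ {p q} → p ≈ q → ∀ i → walk p i ≈ walk q i
  walk-cong {p} {q} p≈q i rewrite offset-cong p≈q i = ≈-+ʳ (offset q i) p≈q

  l : ℕ
  l = lenC D v

  𝟙 : Bool → ℕ
  𝟙 b = if b then 1 else 0

  countC : ℕ → ℕ → ℕ
  countC a zero    = 0
  countC a (suc m) = 𝟙 (onC a) + countC (suc a) m

  countC-+ : ∀ a m m′ → countC a (m + m′) ≡ countC a m + countC (a + m) m′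
  countC-+ a zero    m′ rewrite +-identityʳ a = refl
  countC-+ a (suc m) m′ rewrite countC-+ (suc a) m m′ | +-suc a m = sym (+-assoc (𝟙 (onC a)) _ _)

  countC≡count : ∀ m a (f : Fin m → Bool) → (∀ b → onC (a + toℕ b) ≡ f b) → countC a m ≡ count f
  countC≡count zero    a f f≗ = refl
  countC≡count (suc m) a f f≗ =
    cong₂ _+_ (cong 𝟙 (trans (cong onC (sym (+-identityʳ a))) (f≗ Fin.zero)))
              (countC≡count m (suc a) (f ∘ Fin.suc) (λ b → trans (cong onC (sym (+-suc a (toℕ b)))) (f≗ (Fin.suc b))))

  countC-period : ∀ a → countC a L ≡ l
  countC-period zero    = countC≡count L 0 _ (λ b → cong (λ c → not (indegH D v c ≡ᵇ 2)) (toℕ-mod-inverse b))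
  countC-period (suc a) = trans (+-cancelˡ-≡ (𝟙 (onC a)) _ _ shifted) (countC-period a)
    where
    shifted : 𝟙 (onC a) + countC (suc a) L ≡ 𝟙 (onC a) + countC a L
    shifted = begin
      countC a (1 + L)                   ≡⟨ cong (countC a) (+-comm 1 L) ⟩
      countC a (L + 1)                   ≡⟨ countC-+ a L 1 ⟩
      countC a L + (𝟙 (onC (a + L)) + 0) ≡⟨ cong (λ b → countC a L + (𝟙 b + 0)) (onC-cong (+L≈ a)) ⟩
      countC a L + (𝟙 (onC a) + 0)       ≡⟨ cong (countC a L +_) (+-identityʳ _) ⟩
      countC a L + 𝟙 (onC a)             ≡⟨ +-comm (countC a L) _ ⟩
      𝟙 (onC a) + countC a L             ∎
      where open ≡-Reasoning

  countC-stride : ∀ p → onC p ≡ true → countC p (stride p) ≡ 1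
  countC-stride p onC-p with onC (suc p) in onC-1+p
  ... | true  rewrite onC-p = refl
  ... | false rewrite onC-p | onC-1+p = refl

  countC-offset : ∀ a → onC a ≡ true → ∀ i → countC a (offset a i) ≡ i
  countC-offset a onC-a zero    = refl
  countC-offset a onC-a (suc i) = begin
    countC a (offset a i + stride (walk a i))
      ≡⟨ countC-+ a (offset a i) _ ⟩
    countC a (offset a i) + countC (walk a i) (stride (walk a i))
      ≡⟨ cong₂ _+_ (countC-offset a onC-a i) (countC-stride (walk a i) (onC-walk a onC-a i)) ⟩
    i + 1
      ≡⟨ +-comm i 1 ⟩
    suc i ∎
    where open ≡-Reasoning

  countC-strict : ∀ a {m m′} → m < m′ → onC (a + m) ≡ true → countC a m < countC a m′
  countC-strict a {m} {m′} m<m′ onC-a+m with m≤n⇒∃[o]m+o≡n m<m′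
  ... | t , refl = begin-strict
    countC a m                                    <⟨ m<m+n (countC a m) (s≤s z≤n) ⟩
    countC a m + (1 + countC (suc (a + m)) t)     ≡⟨ cong (λ b → countC a m + (𝟙 b + countC (suc (a + m)) t)) (sym onC-a+m) ⟩
    countC a m + countC (a + m) (suc t)           ≡⟨ countC-+ a m (suc t) ⟨
    countC a (m + suc t)                          ≡⟨ cong (countC a) (+-suc m t) ⟩
    countC a (suc m + t)                          ∎
    where open ≤-Reasoning

  offset-lenC : ∀ a → onC a ≡ true → offset a l ≡ L
  offset-lenC a onC-a with <-cmp (offset a l) L
  ... | tri≈ _ eq _ = eq
  ... | tri< lt _ _ = contradiction (countC-strict a lt (onC-walk a onC-a l)) (<-irrefl equal)
    where equal = trans (countC-offset a onC-a l) (sym (countC-period a))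
  ... | tri> _ _ gt = contradiction (countC-strict a gt (trans (onC-cong (+L≈ a)) onC-a)) (<-irrefl (sym equal))
    where equal = trans (countC-offset a onC-a l) (sym (countC-period a))

  walk-lenC : ∀ a → onC a ≡ true → walk a l ≈ a
  walk-lenC a onC-a = subst (λ o → a + o ≈ a) (sym (offset-lenC a onC-a)) (+L≈ a)

  walk-returns-late : ∀ a → onC a ≡ true → ∀ i t → t < l → walk a i ≈ walk a (i + t) → t ≡ 0
  walk-returns-late a onC-a i t t<l returns = n≤0⇒n≡0 (subst (t ≤_) offset≡0 (i≤offset b t))
    where
    b = walk a i
    offset<L : offset b t < L
    offset<L = subst (offset b t <_) (offset-lenC b (onC-walk a onC-a i)) (offset-strictlyIncreasing b t<l)
    offset≡0 : offset b t ≡ 0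
    offset≡0 = ≈-offset b (offset b t) (≈-sym (subst (b ≈_) (walk-+ a i t) returns)) offset<L

  walk-injective-≤ : ∀ a → onC a ≡ true → ∀ {s i j} → s ≤ i → j < s + l → i ≤ j
                   → walk a i ≈ walk a j → i ≡ j
  walk-injective-≤ a onC-a {s} {i} s≤i j<s+l i≤j eq with m≤n⇒∃[o]m+o≡n i≤j
  ... | t , refl = sym (trans (cong (i +_) t≡0) (+-identityʳ i))
    where
    t≡0 : t ≡ 0
    t≡0 = walk-returns-late a onC-a i t (+-cancelˡ-< i t l (<-≤-trans j<s+l (+-monoˡ-≤ l s≤i))) eq

  walk-injective : ∀ a → onC a ≡ true → ∀ {s i j} → s ≤ i → s ≤ j → i < s + l → j < s + l
                 → walk a i ≈ walk a j → i ≡ j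
  walk-injective a onC-a s≤i s≤j i<s+l j<s+l eq with ≤-total _ _
  ... | inj₁ i≤j = walk-injective-≤ a onC-a s≤i j<s+l i≤j eq
  ... | inj₂ j≤i = sym (walk-injective-≤ a onC-a s≤j i<s+l j≤i (≈-sym eq))

  ShareOutside : ℕ → ℕ → Set
  ShareOutside p q = Σ (Fin n) λ x → Outside x × Arc D (V p) x × Arc D (V q) x

  ShareOutside-cong : ∀ {p p′ q q′} → p ≈ p′ → q ≈ q′ → ShareOutside p q → ShareOutside p′ q′
  ShareOutside-cong p≈p′ q≈q′ (x , out-x , p→x , q→x) =
    x , out-x , subst (λ y → Arc D y x) (V-cong p≈p′) p→x , subst (λ y → Arc D y x) (V-cong q≈q′) q→x

  next≈1+ : ∀ p → onC (suc p) ≡ true → next p ≈ suc p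
  next≈1+ p onC-1+p rewrite onC-1+p = ≈-reflexive (+-comm p 1)

  next≈2+ : ∀ p → onC (suc p) ≡ false → next p ≈ 2 + p
  next≈2+ p ¬onC-1+p rewrite ¬onC-1+p = ≈-reflexive (+-comm p 2)

  arc-on-C : ∀ p q → onC p ≡ true → onC q ≡ true → Arc D (V p) (V q) → next p ≈ q ⊎ next q ≈ p
  arc-on-C p q onC-p onC-q p→q with arc⇒consecutive {p} {q} p→q
  ... | inj₁ 1+p≈q = inj₁ (≈-trans (next≈1+ p (trans (onC-cong 1+p≈q) onC-q)) 1+p≈q)
  ... | inj₂ 1+q≈p = inj₂ (≈-trans (next≈1+ q (trans (onC-cong 1+q≈p) onC-p)) 1+q≈p)

  skips-to : ∀ p q r → suc p ≈ r → suc r ≈ q → Arc D (V p) (V r) → Arc D (V q) (V r) → next p ≈ q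
  skips-to p q r 1+p≈r 1+r≈q p→r q→r = ≈-trans (next≈2+ p (∈Γ⇒¬onC {suc p} 1+p∈Γ)) 2+p≈q
    where
    2+p≈q : 2 + p ≈ q
    2+p≈q = ≈-trans (≈-suc 1+p≈r) 1+r≈q
    1+p∈Γ : InΓ D v (suc p mod L)
    1+p∈Γ = arcs⇒∈Γ p (subst (Arc D (V p)) (sym (V-cong 1+p≈r)) p→r)
                      (subst₂ (Arc D) (sym (V-cong 2+p≈q)) (sym (V-cong 1+p≈r)) q→r)

  common-hole-out-neighbour : ∀ p q r → V p ≢ V q → Arc D (V p) (V r) → Arc D (V q) (V r) → next p ≈ q ⊎ next q ≈ p
  common-hole-out-neighbour p q r p≢q p→r q→r with arc⇒consecutive {p} {r} p→r | arc⇒consecutive {q} {r} q→r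
  ... | inj₁ 1+p≈r | inj₁ 1+q≈r = contradiction (V-cong (≈-pred (≈-trans 1+p≈r (≈-sym 1+q≈r)))) p≢q
  ... | inj₂ 1+r≈p | inj₂ 1+r≈q = contradiction (V-cong (≈-trans (≈-sym 1+r≈p) 1+r≈q)) p≢q
  ... | inj₁ 1+p≈r | inj₂ 1+r≈q = inj₁ (skips-to p q r 1+p≈r 1+r≈q p→r q→r)
  ... | inj₂ 1+r≈p | inj₁ 1+q≈r = inj₂ (skips-to q p r 1+q≈r 1+r≈p q→r p→r)

  PEdge-on-C : ∀ p q → onC p ≡ true → onC q ≡ true → PEdge D (V p) (V q)
             → next p ≈ q ⊎ next q ≈ p ⊎ ShareOutside p q
  PEdge-on-C p q onC-p onC-q (_ , inj₁ p→q)        = [ inj₁ , inj₂ ∘ inj₁ ]′ (arc-on-C p q onC-p onC-q p→q)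
  PEdge-on-C p q onC-p onC-q (_ , inj₂ (inj₁ q→p)) = [ inj₂ ∘ inj₁ , inj₁ ]′ (arc-on-C q p onC-q onC-p q→p)
  PEdge-on-C p q onC-p onC-q (p≢q , inj₂ (inj₂ (w , p→w , q→w))) with any? (λ b → v b ≟ᶠ w)
  ... | no  w∉H      = inj₂ (inj₂ (w , (λ b eq → w∉H (b , eq)) , p→w , q→w))
  ... | yes (b , refl) = [ inj₁ , inj₂ ∘ inj₁ ]′ (common-hole-out-neighbour p q (toℕ b) p≢q
                             (subst (Arc D (V p)) (sym (V-toℕ b)) p→w) (subst (Arc D (V q)) (sym (V-toℕ b)) q→w))

  open HoleFromCycle (PEdge D) (InC D v) (PEdge? D) (PEdge-sym D) (PEdge-irrefl D)

  onC⇒InC : ∀ p → onC p ≡ true → InC D v (V p)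
  onC⇒InC p onC-p = p mod L , refl , onC⇒∉Γ {p} onC-p

  walk-zero : ∀ b → walk b 0 ≡ b
  walk-zero b = +-identityʳ b

  next-walk : ∀ b t {q} → next (walk b t) ≈ q → walk b (suc t) ≈ q
  next-walk b t {q} = subst (_≈ q) (sym (walk-suc b t))

  PEdge-walk : ∀ b t → PEdge D (V (walk b t)) (V (walk b (suc t)))
  PEdge-walk b t = subst (λ z → PEdge D (V (walk b t)) (V z)) (sym (walk-suc b t)) (PEdge-next (walk b t))

  walk-cycle : ∀ b → onC b ≡ true → ∀ k → k < l → PEdge D (V (walk b 0)) (V (walk b k))
             → (∀ t → 0 < t → t < k → PEdge D (V (walk b 0)) (V (walk b t)) → PEdge D (V (walk b t)) (V (walk b k))
                → ⊥)
             → Cycle k (λ t → V (walk b t))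
  walk-cycle b onC-b k k<l closing triangle-free = record
    { injective             = λ i j i≤k j≤k eq →
                                walk-injective b onC-b z≤n z≤n (≤-<-trans i≤k k<l) (≤-<-trans j≤k k<l) (V-injective eq)
    ; adjacent              = λ t _ → PEdge-walk b t
    ; closing               = closing
    ; closing-triangle-free = triangle-free
    ; inside                = λ t _ → onC⇒InC (walk b t) (onC-walk b onC-b t)
    }

  NoSharedOutside : Set
  NoSharedOutside = ∀ b → onC b ≡ true → ∀ m → 0 < m → m < l → ¬ ShareOutside b (walk b m)

  no-shared-outside⇒hole : NoSharedOutside → ∀ a → onC a ≡ true → 4 ≤ l → HasHoleIn (PEdge D) (InC D v)
  no-shared-outside⇒hole no-share a onC-a 4≤l = hole-from-cycle k _ 3≤k (walk-cycle a onC-a k k<l closing triangle-free)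
    where
    k = l ∸ 1
    1+k≡l : suc k ≡ l
    1+k≡l = m+[n∸m]≡n (≤-trans (s≤s z≤n) 4≤l)
    3≤k : 3 ≤ k
    3≤k = s≤s⁻¹ (subst (4 ≤_) (sym 1+k≡l) 4≤l)
    2≤k = ≤-trans (s≤s (s≤s z≤n)) 3≤k
    1≤k = ≤-trans (s≤s z≤n) 3≤k
    ≤k⇒<l : ∀ {t} → t ≤ k → t < l
    ≤k⇒<l {t} t≤k = subst (t <_) 1+k≡l (s≤s t≤k)
    k<l : k < l
    k<l = ≤k⇒<l ≤-refl
    injective : ∀ {i j} → i ≤ k → j ≤ k → walk a i ≈ walk a j → i ≡ j
    injective i≤k j≤k = walk-injective a onC-a z≤n z≤n (≤k⇒<l i≤k) (≤k⇒<l j≤k)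
    on-C : ∀ t → onC (walk a t) ≡ true
    on-C = onC-walk a onC-a
    wraps : walk a (suc k) ≈ walk a 0
    wraps = subst (λ t → walk a t ≈ walk a 0) (sym 1+k≡l) (≈-trans (walk-lenC a onC-a) (≈-reflexive (sym (walk-zero a))))
    closing : PEdge D (V (walk a 0)) (V (walk a k))
    closing = PEdge-sym D (subst (PEdge D (V (walk a k))) (V-cong wraps) (PEdge-walk a k))
    second-last : PEdge D (V (walk a 1)) (V (walk a k)) → ⊥
    second-last e with PEdge-on-C (walk a 1) (walk a k) (on-C 1) (on-C k) e
    ... | inj₁ next≈ = contradiction (injective 2≤k ≤-refl (next-walk a 1 next≈)) (λ 2≡k → <-irrefl 2≡k 3≤k)
    ... | inj₂ (inj₁ next≈) with () ← injective {0} {1} z≤n 1≤k (≈-trans (≈-sym wraps) (next-walk a k next≈))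
    ... | inj₂ (inj₂ share) = no-share (walk a 1) (on-C 1) (k ∸ 1) (m<n⇒0<n∸m 2≤k) (≤-<-trans (m∸n≤m k 1) k<l)
                                (subst (ShareOutside (walk a 1)) walk-k share)
      where
      walk-k : walk a k ≡ walk (walk a 1) (k ∸ 1)
      walk-k = trans (cong (walk a) (sym (m+[n∸m]≡n 1≤k))) (walk-+ a 1 (k ∸ 1))
    triangle-free : ∀ t → 0 < t → t < k → PEdge D (V (walk a 0)) (V (walk a t)) → PEdge D (V (walk a t)) (V (walk a k))
                  → ⊥
    triangle-free t 0<t t<k e₁ e₂ with PEdge-on-C (walk a 0) (walk a t) (on-C 0) (on-C t) e₁
    ... | inj₁ next≈ with injective {1} {t} 1≤k (<⇒≤ t<k) (next-walk a 0 next≈)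
    ...   | refl = second-last e₂
    triangle-free t 0<t t<k e₁ e₂ | inj₂ (inj₁ next≈) with () ← injective t<k z≤n (next-walk a t next≈)
    triangle-free t 0<t t<k e₁ e₂ | inj₂ (inj₂ share) =
      no-share (walk a 0) (on-C 0) t 0<t (≤k⇒<l (<⇒≤ t<k)) (subst (ShareOutside (walk a 0)) (walk-+ a 0 t) share)

  gap⇒hole : ∀ b x u → onC b ≡ true → Outside x → Arc D (V (walk b 0)) x → 2 ≤ u → suc u < l
           → (∀ t → 0 < t → t ≤ u → ¬ Arc D (V (walk b t)) x) → Arc D (V (walk b (suc u))) x
           → HasHoleIn (PEdge D) (InC D v)
  gap⇒hole b x u onC-b out-x b→x 2≤u 1+u<l silent last→x =
    hole-from-cycle (suc u) _ (s≤s 2≤u) (walk-cycle b onC-b (suc u) 1+u<l closing triangle-free)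
    where
    on-C : ∀ t → onC (walk b t) ≡ true
    on-C = onC-walk b onC-b
    injective : ∀ {i j} → i ≤ suc u → j ≤ suc u → walk b i ≈ walk b j → i ≡ j
    injective i≤ j≤ = walk-injective b onC-b z≤n z≤n (≤-<-trans i≤ 1+u<l) (≤-<-trans j≤ 1+u<l)
    closing : PEdge D (V (walk b 0)) (V (walk b (suc u)))
    closing = (λ eq → 0≢1+n (injective z≤n ≤-refl (V-injective eq))) , inj₂ (inj₂ (x , b→x , last→x))
    x-is-the-outside : ∀ t {w} → Outside w → Arc D (V (walk b t)) w → Arc D (V (walk b t)) x → w ≡ x
    x-is-the-outside t out-w t→w t→x = outside-out-neighbour-unique (walk b t) (on-C t) t→w t→x out-w out-x
    second-last : PEdge D (V (walk b 1)) (V (walk b (suc u))) → ⊥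
    second-last e with PEdge-on-C (walk b 1) (walk b (suc u)) (on-C 1) (on-C (suc u)) e
    ... | inj₁ next≈ = contradiction (injective (m≤n⇒m≤1+n 2≤u) ≤-refl (next-walk b 1 next≈))
                         (λ 2≡1+u → <-irrefl (suc-injective 2≡1+u) 2≤u)
    ... | inj₂ (inj₁ next≈)
      with () ← walk-injective b onC-b {1} {suc (suc u)} {1} (s≤s z≤n) ≤-refl (s≤s 1+u<l) (s≤s (≤-<-trans z≤n 1+u<l))
                                            (next-walk b (suc u) next≈)
    ... | inj₂ (inj₂ (w , out-w , 1→w , last→w)) =
          silent 1 (s≤s z≤n) (≤-trans (s≤s z≤n) 2≤u)
            (subst (Arc D (V (walk b 1))) (x-is-the-outside (suc u) out-w last→w last→x) 1→w)
    triangle-free : ∀ t → 0 < t → t < suc u → PEdge D (V (walk b 0)) (V (walk b t))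
                  → PEdge D (V (walk b t)) (V (walk b (suc u))) → ⊥
    triangle-free t 0<t t<1+u e₁ e₂ with PEdge-on-C (walk b 0) (walk b t) (on-C 0) (on-C t) e₁
    ... | inj₁ next≈ with injective {1} {t} (s≤s z≤n) (<⇒≤ t<1+u) (next-walk b 0 next≈)
    ...   | refl = second-last e₂
    triangle-free t 0<t t<1+u e₁ e₂ | inj₂ (inj₁ next≈) with () ← injective t<1+u z≤n (next-walk b t next≈)
    triangle-free t 0<t t<1+u e₁ e₂ | inj₂ (inj₂ (w , out-w , 0→w , t→w)) =
      silent t 0<t (s≤s⁻¹ t<1+u) (subst (Arc D (V (walk b t))) (x-is-the-outside 0 out-w 0→w b→x) t→w)

  CliqueBound : Set
  CliqueBound = ∀ K → IsCliqueIn (PEdge D) (InC D v) K → length K ≤ (l ∸ 1) / 2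

  module Pointing (a : ℕ) (onC-a : onC a ≡ true) (x : Fin n) (out-x : Outside x) (a→x : Arc D (V a) x)
    (m : ℕ) (0<m : 0 < m) (m<l : m < l) (m→x : Arc D (V (walk a m)) x) where

    points : ℕ → Bool
    points t = D (V (walk a t)) x

    points-0 : points 0 ≡ true
    points-0 = subst (λ p → Arc D (V p) x) (sym (walk-zero a)) a→x

    points-l : points l ≡ true
    points-l = subst (λ y → Arc D y x) (sym (V-cong (walk-lenC a onC-a))) a→x

    pointers : List (Fin n)
    pointers = select points (V ∘ walk a) l

    pointers-clique : IsCliqueIn (PEdge D) (InC D v) pointers
    pointers-clique = select-unique points (V ∘ walk a) l
                        (λ i<l j<l eq → walk-injective a onC-a z≤n z≤n i<l j<l (V-injective eq))
                    , All.tabulate in-C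
                    , λ y∈ z∈ y≢z → y≢z , inj₂ (inj₂ (x , points-at y∈ , points-at z∈))
      where
      in-C : ∀ {y} → y ∈ pointers → InC D v y
      in-C y∈ with ∈-select points (V ∘ walk a) l y∈
      ... | t , _ , _ , refl = onC⇒InC (walk a t) (onC-walk a onC-a t)
      points-at : ∀ {y} → y ∈ pointers → Arc D y x
      points-at y∈ with ∈-select points (V ∘ walk a) l y∈
      ... | t , _ , t→x , refl = t→x

    Gap : ℕ → Set
    Gap i = suc (suc i) < l × points i ≡ true × points (suc i) ≡ false × points (suc (suc i)) ≡ false

    gap? : ∀ i → Dec (Gap i)
    gap? i = suc (suc i) <? l ×-dec points i ≟ᵇ true ×-dec points (suc i) ≟ᵇ false ×-dec points (suc (suc i)) ≟ᵇ false

    no-gap⇒gapless : ¬ (∃ λ i → i < l × Gap i) → Gapless points l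
    no-gap⇒gapless ∄gap t 2+t<l t→x with points (suc t) in 1+t→x | points (suc (suc t)) in 2+t→x
    ... | true  | _     = inj₁ refl
    ... | false | true  = inj₂ refl
    ... | false | false = contradiction (t , t<l , 2+t<l , t→x , 1+t→x , 2+t→x) ∄gap
      where t<l = <-trans (n<1+n t) (<-trans (n<1+n (suc t)) 2+t<l)

    gap-exists : CliqueBound → ∃ Gap
    gap-exists bound with anyUpTo? gap? l
    ... | yes (i , _ , gap) = i , gap
    ... | no  ∄gap          = contradiction (≤-trans dense sparse) (<⇒≱ l∸1<l)
      where
      q = (l ∸ 1) / 2
      c = countBelow points l
      c≤q : c ≤ q
      c≤q = subst (_≤ q) (length-select points (V ∘ walk a) l) (bound pointers pointers-clique)
      dense : l ≤ c + c
      dense = gapless⇒dense points l points-0 (no-gap⇒gapless ∄gap)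
      sparse : c + c ≤ l ∸ 1
      sparse = ≤-trans (+-mono-≤ c≤q c≤q) (subst (_≤ l ∸ 1) q*2≡q+q (m/n*n≤m (l ∸ 1) 2))
        where q*2≡q+q = trans (*-comm q 2) (cong (q +_) (+-identityʳ q))
      l∸1<l : l ∸ 1 < l
      l∸1<l = ∸-monoʳ-< {l} {1} {0} (s≤s z≤n) (≤-trans (s≤s z≤n) m<l)

    gap⇒hole-at : ∀ i → Gap i → HasHoleIn (PEdge D) (InC D v)
    gap⇒hole-at i (2+i<l , i→x , 1+i↛x , 2+i↛x)
      with least-true (λ s → points (suc i + s)) (l ∸ suc i) (trans (cong points (m+[n∸m]≡n 1+i≤l)) points-l)
      where 1+i≤l = <⇒≤ (<-trans (n<1+n (suc i)) 2+i<l)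
    ... | u , u≤l-1-i , 1+i+u→x , silent-before =
      gap⇒hole b x u (onC-walk a onC-a i) out-x b→x 2≤u 1+u<l silent (trans (sym (from-b u)) 1+i+u→x)
      where
      b = walk a i
      from-b : ∀ s → points (suc i + s) ≡ D (V (walk b (suc s))) x
      from-b s = trans (cong points (sym (+-suc i s))) (cong (λ p → D (V p) x) (walk-+ a i (suc s)))
      b→x : Arc D (V (walk b 0)) x
      b→x = trans (cong (λ p → D (V p) x) (sym (walk-+ a i 0))) (trans (cong points (+-identityʳ i)) i→x)
      u-least : ∀ t → points (suc i + t) ≡ true → u ≤ t
      u-least t t→x with t <? u
      ... | yes t<u = contradiction (trans (sym t→x) (silent-before t t<u)) λ ()
      ... | no  t≮u = ≮⇒≥ t≮u
      beyond-gap : ∀ w → points (suc i + w) ≡ true → 2 ≤ w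
      beyond-gap zero          1+i→x = contradiction (trans (sym 1+i→x) (trans (cong points (+-identityʳ (suc i))) 1+i↛x)) λ ()
      beyond-gap (suc zero)    2+i→x = contradiction (trans (sym 2+i→x) (trans (cong points (+-comm (suc i) 1)) 2+i↛x)) λ ()
      beyond-gap (suc (suc _)) _     = s≤s (s≤s z≤n)
      2≤u : 2 ≤ u
      2≤u = beyond-gap u 1+i+u→x
      1+u<l : suc u < l
      1+u<l with suc i ≤? m
      ... | yes 1+i≤m = ≤-<-trans (s≤s (≤-trans (u-least (m ∸ suc i) (trans (cong points (m+[n∸m]≡n 1+i≤m)) m→x)) (m≤n+m _ i)))
                          (subst (_< l) (sym (m+[n∸m]≡n 1+i≤m)) m<l)
      ... | no  1+i≰m = ≤-trans (s≤s (subst (_≤ u + i) (+-comm u 1) (+-monoʳ-≤ u 1≤i))) (subst (_≤ l) (+-suc u i) u+1+i≤l)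
        where
        1≤i : 1 ≤ i
        1≤i = ≤-trans 0<m (s≤s⁻¹ (≰⇒> 1+i≰m))
        u+1+i≤l : u + suc i ≤ l
        u+1+i≤l = ≤-trans (+-monoˡ-≤ (suc i) u≤l-1-i) (≤-reflexive (m∸n+n≡m (<⇒≤ (<-trans (n<1+n (suc i)) 2+i<l))))
      silent : ∀ t → 0 < t → t ≤ u → ¬ Arc D (V (walk b t)) x
      silent (suc t) _ 1+t≤u t→x with () ← trans (sym t→x) (trans (sym (from-b t)) (silent-before t 1+t≤u))

    shared-outside⇒hole : CliqueBound → HasHoleIn (PEdge D) (InC D v)
    shared-outside⇒hole bound = let (i , gap) = gap-exists bound in gap⇒hole-at i gap

  Outside? : ∀ x → Dec (Outside x)
  Outside? x = all? (λ b → ¬? (v b ≟ᶠ x))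

  ShareOutside? : ∀ p q → Dec (ShareOutside p q)
  ShareOutside? p q = any? (λ x → Outside? x ×-dec D (V p) x ≟ᵇ true ×-dec D (V q) x ≟ᵇ true)

  C-has-hole : 4 ≤ l → CliqueBound → HasHoleIn (PEdge D) (InC D v)
  C-has-hole 4≤l bound
    with any? (λ b → onC (toℕ b) ≟ᵇ true
                ×-dec anyUpTo? (λ m → 0 <? m ×-dec ShareOutside? (toℕ b) (walk (toℕ b) m)) l)
  ... | yes (b , onC-b , m , m<l , 0<m , x , out-x , b→x , m→x) =
        Pointing.shared-outside⇒hole (toℕ b) onC-b x out-x b→x m 0<m m<l m→x bound
  ... | no ∄shared = no-shared-outside⇒hole no-share a onC-a 4≤l
    where
    no-share : NoSharedOutside
    no-share p onC-p m 0<m m<l share =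
      ∄shared (p mod L , onC-b , m , m<l , 0<m , ShareOutside-cong (≈-sym b≈p) (walk-cong (≈-sym b≈p) m) share)
      where
      b≈p : toℕ (p mod L) ≈ p
      b≈p = ≈-trans (≈-reflexive (toℕ-mod p)) (%≈ p)
      onC-b = trans (onC-cong b≈p) onC-p
    C-position : ∃ λ (b : Fin L) → onC (toℕ b) ≡ true
    C-position with 0<count⇒∃ _ (≤-trans (s≤s z≤n) 4≤l)
    ... | b , onC-b = b , trans (cong (λ c → not (indegH D v c ≡ᵇ 2)) (toℕ-mod-inverse b)) onC-b
    a = toℕ (proj₁ C-position)
    onC-a = proj₂ C-position

theorem2p5 : (i : ℕ) → 1 ≤ i → (n : ℕ) → (D : Digraph n) → IJDigraph D i 2
    → (L : ℕ) → (v : Fin L → Fin n) → 5 ≤ L → IsHole (UEdge D) L v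
    → 4 ≤ lenC D v
    → (∀ (K : List (Fin n)) → IsCliqueIn (PEdge D) (InC D v) K → length K ≤ (lenC D v ∸ 1) / 2)
    → HasHoleIn (PEdge D) (InC D v)
theorem2p5 i _ n D (acyclic , _ , outdeg≤2) (suc L₀) v 5≤L hole 4≤l clique-bound =
  OnHole.C-has-hole D L₀ v acyclic outdeg≤2 hole 5≤L 4≤l clique-bound
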